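{- Let $\mathcal{G}$ be a directed graph with vertex set $\{0,1,\dots,n-1\}$ and no loops. If a circuit, a periodic orbit, or a pseudo orbit on $\mathcal{G}$ has walk sum $mn$ with $m\in\mathbb{N}$, then it passes every vertex of $\mathcal{G}$ exactly $m$ times.
   Context: Vertices are identified with $\mathbb{Z}/n\mathbb{Z}$; a loop is a bond $(v,v)$. The arc of a bond $(v_0,v_1)$ is $(v_1-v_0)\bmod n\in\{0,\dots,n-1\}$. A walk is a sequence of vertices $v_0,\dots,v_l$ with each $(v_i,v_{i+1})$ a bond; a circuit is a walk with $v_l=v_0$; its walk sum is the sum of the arcs of its bonds counted with repetition. A periodic orbit is an equivalence class of circuits under cyclic rotation (walk sum = that of any of its circuits); a pseudo orbit is a finite collection of periodic orbits (walk sum = sum of those of its periodic orbits). A bond $(v_0,v_1)$ passes a vertex $v$ if $(v-v_0)\bmod n<(v_1-v_0)\bmod n$ (so in particular it passes its origin $v_0$). The number of times a circuit passes $v$ is the number of bonds of the circuit, counted with repetition, that pass $v$; a periodic orbit passes $v$ as often as any of its circuits does; a pseudo orbit passes $v$ the total number of times its periodic orbits pass $v$. -}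

module Defs where

open import Data.Nat using (ℕ; zero; suc; _+_; _*_; _∸_; _<ᵇ_; NonZero)
open import Data.Nat.DivMod using (_%_)
open import Data.Fin using (Fin; toℕ)
open import Data.Bool using (Bool; if_then_else_)
open import Data.List using (List; []; _∷_; map)
open import Data.Nat.ListAction using (sum)
open import Data.List.Relation.Unary.All using (All)
open import Data.Product using (_×_; _,_)
open import Relation.Nullary using (¬_)
open import Relation.Binary.PropositionalEquality using (_≡_)

-- A directed graph on the vertex set Fin n (identified with ℤ/nℤ):
-- a bond relation.
Graph : ℕ → Set₁
Graph n = Fin n → Fin n → Set

NoLoops : {n : ℕ} → Graph n → Set
NoLoops {n} G = (v : Fin n) → ¬ G v v

module _ (n : ℕ) .{{_ : NonZero n}} where

  modDiff : Fin n → Fin n → ℕ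
  modDiff a b = (n + toℕ a ∸ toℕ b) % n

  arc : Fin n × Fin n → ℕ
  arc (v₀ , v₁) = modDiff v₁ v₀

  passesB : Fin n × Fin n → Fin n → Bool
  passesB (v₀ , v₁) v = modDiff v v₀ <ᵇ modDiff v₁ v₀

-- consecutive bonds of the walk v₀ , v₁ , … , v_l  (given as v₀ and [v₁,…,v_l])
bondsFrom : {n : ℕ} → Fin n → List (Fin n) → List (Fin n × Fin n)
bondsFrom v []       = []
bondsFrom v (w ∷ ws) = (v , w) ∷ bondsFrom w ws

endV : {n : ℕ} → Fin n → List (Fin n) → Fin n
endV v []       = v
endV v (w ∷ ws) = endV w ws

record Circuit {n : ℕ} (G : Graph n) : Set where
  constructor circuit
  field
    start  : Fin n
    rest   : List (Fin n)
    isWalk : All (λ b → G (Data.Product.proj₁ b) (Data.Product.proj₂ b)) (bondsFrom start rest)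
    closed : endV start rest ≡ start

  bonds : List (Fin n × Fin n)
  bonds = bondsFrom start rest

open Circuit public using (bonds)

module _ {n : ℕ} .{{_ : NonZero n}} {G : Graph n} where

  walkSum : Circuit G → ℕ
  walkSum c = sum (map (arc n) (bonds c))

  passes : Circuit G → Fin n → ℕ
  passes c v = sum (map (λ b → if passesB n b v then 1 else 0) (bonds c))

-- A periodic orbit is an equivalence class of circuits under cyclic rotation;
-- we represent it by one of its circuits. Its walk sum and passing numbers are,
-- by definition, those of any of its circuits (they are rotation invariant).
record PeriodicOrbit {n : ℕ} (G : Graph n) : Set where
  constructor orbit
  field
    representative : Circuit G

PseudoOrbit : {n : ℕ} → Graph n → Set
PseudoOrbit G = List (PeriodicOrbit G)

module _ {n : ℕ} .{{_ : NonZero n}} {G : Graph n} where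

  walkSumPO : PeriodicOrbit G → ℕ
  walkSumPO γ = walkSum (PeriodicOrbit.representative γ)

  passesPO : PeriodicOrbit G → Fin n → ℕ
  passesPO γ v = passes (PeriodicOrbit.representative γ) v

  walkSumPseudo : PseudoOrbit G → ℕ
  walkSumPseudo γs = sum (map walkSumPO γs)

  passesPseudo : PseudoOrbit G → Fin n → ℕ
  passesPseudo γs v = sum (map (λ γ → passesPO γ v) γs)

{-# OPTIONS --safe #-}
module Submission where

-- Fix a vertex v and use the potential d u = (v − u) mod n, a number in [0, n).
-- Along a bond (a , b) we have d a ≡ d b + arc (a , b) modulo n, and the sum
-- d b + arc (a , b) reaches n exactly when the bond passes v; so
-- d a + n · [the bond passes v] = d b + arc (a , b).  Summed along a circuit the
-- potentials telescope, leaving n · (number of passes of v) = walk sum.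

open import Defs
open import Data.Nat using (ℕ; _*_; NonZero; _+_; _∸_; _<_; _≤_; _<ᵇ_)
open import Data.Nat.Properties
open import Data.Nat.DivMod using (_%_; m%n<n; m<n⇒m%n≡m; [m+n]%n≡m%n; m≤n⇒[n∸m]%m≡n%m; %-distribˡ-+)
open import Algebra.Properties.CommutativeSemigroup +-commutativeSemigroup using (xy∙z≈xz∙y; xy∙z≈x∙zy)
open import Data.Nat.Solver using (module +-*-Solver)
open import Data.Fin using (Fin; toℕ)
open import Data.Fin.Properties using (toℕ<n)
open import Data.Bool using (Bool; true; false; if_then_else_)
open import Data.List using (List; []; _∷_; map)
open import Data.Nat.ListAction using (sum)
open import Data.Product using (_×_; _,_)
open import Relation.Nullary using (yes; no; ¬_)
open import Relation.Nullary.Reflects using (ofʸ; ofⁿ)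
open import Relation.Binary.PropositionalEquality

open +-*-Solver using (solve; _:+_; _:=_)

ind : Bool → ℕ
ind b = if b then 1 else 0

ind[m<ᵇn]≡1 : ∀ {m n} → m < n → ind (m <ᵇ n) ≡ 1
ind[m<ᵇn]≡1 {m} {n} m<n with m <ᵇ n | <ᵇ-reflects-< m n
... | true  | _        = refl
... | false | ofⁿ m≮n with () ← m≮n m<n

ind[m<ᵇn]≡0 : ∀ {m n} → ¬ m < n → ind (m <ᵇ n) ≡ 0
ind[m<ᵇn]≡0 {m} {n} m≮n with m <ᵇ n | <ᵇ-reflects-< m n
... | true  | ofʸ m<n with () ← m≮n m<n
... | false | _        = refl

x+y∸n<y : ∀ {n x y} → x < n → n ≤ x + y → x + y ∸ n < y
x+y∸n<y {n} {x} {y} x<n n≤x+y = +-cancelʳ-< n (x + y ∸ n) y (begin-strict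
  x + y ∸ n + n ≡⟨ m∸n+n≡m n≤x+y ⟩
  x + y         <⟨ +-monoˡ-< y x<n ⟩
  n + y         ≡⟨ +-comm n y ⟩
  y + n         ∎)
  where open ≤-Reasoning

-- Adding two residues modulo n loses n exactly when the result drops below a summand.
[x+y]%n+carry≡x+y : ∀ n .{{_ : NonZero n}} {x y} → x < n → y < n →
  (x + y) % n + n * ind ((x + y) % n <ᵇ y) ≡ x + y
[x+y]%n+carry≡x+y n {x} {y} x<n y<n with x + y <? n
... | yes x+y<n = begin
  (x + y) % n + n * ind ((x + y) % n <ᵇ y) ≡⟨ cong (λ r → r + n * ind (r <ᵇ y)) r≡x+y ⟩
  x + y + n * ind (x + y <ᵇ y)             ≡⟨ cong (λ i → x + y + n * i) (ind[m<ᵇn]≡0 (≤⇒≯ (m≤n+m y x))) ⟩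
  x + y + n * 0                            ≡⟨ cong (x + y +_) (*-zeroʳ n) ⟩
  x + y + 0                                ≡⟨ +-identityʳ (x + y) ⟩
  x + y                                    ∎
  where
  open ≡-Reasoning
  r≡x+y : (x + y) % n ≡ x + y
  r≡x+y = m<n⇒m%n≡m x+y<n
... | no x+y≮n = begin
  (x + y) % n + n * ind ((x + y) % n <ᵇ y) ≡⟨ cong (λ r → r + n * ind (r <ᵇ y)) r≡k ⟩
  k + n * ind (k <ᵇ y)                     ≡⟨ cong (λ i → k + n * i) (ind[m<ᵇn]≡1 k<y) ⟩
  k + n * 1                                ≡⟨ cong (k +_) (*-identityʳ n) ⟩
  k + n                                    ≡⟨ m∸n+n≡m n≤x+y ⟩
  x + y                                    ∎
  where
  open ≡-Reasoning
  k = x + y ∸ n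
  n≤x+y : n ≤ x + y
  n≤x+y = ≮⇒≥ x+y≮n
  k<y : k < y
  k<y = x+y∸n<y x<n n≤x+y
  r≡k : (x + y) % n ≡ k
  r≡k = trans (sym (m≤n⇒[n∸m]%m≡n%m n≤x+y)) (m<n⇒m%n≡m (<-trans k<y y<n))

modDiff-trans : ∀ n .{{_ : NonZero n}} (v a b : Fin n) →
  modDiff n v a ≡ (modDiff n v b + modDiff n b a) % n
modDiff-trans n v a b = sym (begin
  ((n + V ∸ B) % n + (n + B ∸ A) % n) % n ≡⟨ %-distribˡ-+ (n + V ∸ B) (n + B ∸ A) n ⟨
  ((n + V ∸ B) + (n + B ∸ A)) % n         ≡⟨ cong (_% n) sum≡ ⟩
  ((n + V ∸ A) + n) % n                   ≡⟨ [m+n]%n≡m%n (n + V ∸ A) n ⟩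
  (n + V ∸ A) % n                         ∎)
  where
  open ≡-Reasoning
  V = toℕ v
  A = toℕ a
  B = toℕ b
  A≤n : A ≤ n
  A≤n = <⇒≤ (toℕ<n a)
  B≤n : B ≤ n
  B≤n = <⇒≤ (toℕ<n b)
  sum≡ : (n + V ∸ B) + (n + B ∸ A) ≡ (n + V ∸ A) + n
  sum≡ = begin
    (n + V ∸ B) + (n + B ∸ A) ≡⟨ cong₂ _+_ (+-∸-comm V B≤n) (+-∸-comm B A≤n) ⟩
    (n ∸ B + V) + (n ∸ A + B) ≡⟨ solve 4 (λ p V q B → (p :+ V) :+ (q :+ B) := (q :+ V) :+ (p :+ B))
                                   refl (n ∸ B) V (n ∸ A) B ⟩
    (n ∸ A + V) + (n ∸ B + B) ≡⟨ cong₂ _+_ (sym (+-∸-comm V A≤n)) (m∸n+n≡m B≤n) ⟩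
    (n + V ∸ A) + n           ∎

modDiff-bond : ∀ n .{{_ : NonZero n}} (v a b : Fin n) →
  modDiff n v a + n * ind (passesB n (a , b) v) ≡ modDiff n v b + arc n (a , b)
modDiff-bond n v a b =
  subst (λ z → z + n * ind (z <ᵇ modDiff n b a) ≡ modDiff n v b + modDiff n b a)
    (sym (modDiff-trans n v a b))
    ([x+y]%n+carry≡x+y n (m%n<n _ n) (m%n<n _ n))

module Telescope {n : ℕ} (k : ℕ) (d : Fin n → ℕ) (p w : Fin n × Fin n → ℕ)
  (bond : ∀ a b → d a + k * p (a , b) ≡ d b + w (a , b)) where

  telescope : ∀ s ws →
    d s + k * sum (map p (bondsFrom s ws)) ≡ d (endV s ws) + sum (map w (bondsFrom s ws))
  telescope s []       = cong (d s +_) (*-zeroʳ k)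
  telescope s (t ∷ ws) = begin
    d s + k * (p (s , t) + P)          ≡⟨ cong (d s +_) (*-distribˡ-+ k (p (s , t)) P) ⟩
    d s + (k * p (s , t) + k * P)      ≡⟨ +-assoc (d s) _ _ ⟨
    (d s + k * p (s , t)) + k * P      ≡⟨ cong (_+ k * P) (bond s t) ⟩
    (d t + w (s , t)) + k * P          ≡⟨ xy∙z≈xz∙y (d t) (w (s , t)) (k * P) ⟩
    (d t + k * P) + w (s , t)          ≡⟨ cong (_+ w (s , t)) (telescope t ws) ⟩
    (d (endV t ws) + W) + w (s , t)    ≡⟨ xy∙z≈x∙zy (d (endV t ws)) W (w (s , t)) ⟩
    d (endV t ws) + (w (s , t) + W)    ∎
    where
    open ≡-Reasoning
    P = sum (map p (bondsFrom t ws))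
    W = sum (map w (bondsFrom t ws))

module _ {n : ℕ} .{{_ : NonZero n}} {G : Graph n} where

  passes*n≡walkSum : (c : Circuit G) (v : Fin n) → passes c v * n ≡ walkSum c
  passes*n≡walkSum (circuit s ws _ closed) v = begin
    P * n ≡⟨ *-comm P n ⟩
    n * P ≡⟨ +-cancelˡ-≡ (modDiff n v s) (n * P) W
               (trans (telescope s ws) (cong (λ e → modDiff n v e + W) closed)) ⟩
    W     ∎
    where
    open ≡-Reasoning
    open Telescope n (modDiff n v) (λ b → ind (passesB n b v)) (arc n) (modDiff-bond n v)
    P = sum (map (λ b → ind (passesB n b v)) (bondsFrom s ws))
    W = sum (map (arc n) (bondsFrom s ws))

  passesPseudo*n≡walkSumPseudo : (γs : PseudoOrbit G) (v : Fin n) →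
    passesPseudo γs v * n ≡ walkSumPseudo γs
  passesPseudo*n≡walkSumPseudo []             v = refl
  passesPseudo*n≡walkSumPseudo (orbit c ∷ γs) v = begin
    (passes c v + passesPseudo γs v) * n     ≡⟨ *-distribʳ-+ n (passes c v) (passesPseudo γs v) ⟩
    passes c v * n + passesPseudo γs v * n   ≡⟨ cong₂ _+_ (passes*n≡walkSum c v) (passesPseudo*n≡walkSumPseudo γs v) ⟩
    walkSum c + walkSumPseudo γs             ∎
    where open ≡-Reasoning

lemma2 : (n : ℕ) .{{_ : NonZero n}} (G : Graph n) → NoLoops G → (m : ℕ) →
    ((c : Circuit G) → walkSum c ≡ m * n → (v : Fin n) → passes c v ≡ m)
    × ((γ : PeriodicOrbit G) → walkSumPO γ ≡ m * n → (v : Fin n) → passesPO γ v ≡ m)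
    × ((γs : PseudoOrbit G) → walkSumPseudo γs ≡ m * n → (v : Fin n) → passesPseudo γs v ≡ m)
lemma2 n G _ m =
    (λ c sum≡ v → cancel (trans (passes*n≡walkSum c v) sum≡))
  , (λ γ sum≡ v → cancel (trans (passes*n≡walkSum (PeriodicOrbit.representative γ) v) sum≡))
  , (λ γs sum≡ v → cancel (trans (passesPseudo*n≡walkSumPseudo γs v) sum≡))
  where
  cancel : ∀ {p} → p * n ≡ m * n → p ≡ m
  cancel = *-cancelʳ-≡ _ m n
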